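{- Let $X$ be a finite metric space, $a_0\in X$, $P\subseteq\mathcal{P}_X$ with $P=P^{ -1}$ and $X\setminus\{a_0\}\subseteq P(a_0)$. Let $(Y,\phi)$ be a $P$-type S-extension of $X$ and $N=\ker(\phi)$. Then $N$ satisfies conditions (C1), (C2) and (C3).
   Context: A partial isometry of $X$ is an isometry between finite subsets of $X$; $\mathcal{P}_X$ is the set of those not contained in the identity; $P(a_0)=\{p(a_0):p\in P,\ a_0\in\mathrm{dom}(p)\}$. A $P$-type S-extension of $X$ is $(Y,\phi)$ with $Y$ a metric space extending $X$ ($X\subseteq Y$, $d_Y\restriction X=d_X$) and $\phi:P\to\mathrm{Iso}(Y)$ with $\phi(p)\restriction\mathrm{dom}(p)=p$; assuming $\phi(p^{ -1})=\phi(p)^{ -1}$, $\phi$ is extended to a group homomorphism $\mathbb{F}(P)\to\mathrm{Iso}(Y)$, where $\mathbb{F}(P)$ is the free group on $P$ with $p^{ -1}\in P$ identified with the formal inverse of $p$; $\ker(\phi)$ is the kernel of this homomorphism. $H\le\mathbb{F}(P)$ is the subgroup of elements represented by words $p_1\cdots p_n$ ($p_i\in P$) such that $p_1(p_2(\cdots p_n(a_0)\cdots))$ is defined and equals $a_0$. For $N\trianglelefteq\mathbb{F}(P)$ (all $p,q,r,s,r_i,s_i\in P\cup\{1\}$ below are assumed defined at $a_0$): (C1) if $d_X(p(a_0),q(a_0))\ne d_X(r(a_0),s(a_0))$ then $N\cap pHr^{ -1}sHq^{ -1}=\emptyset$; (C2) if $p(a_0)\ne q(a_0)$ then $N\cap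 pHq^{ -1}=\emptyset$; (C3) for $n\ge1$, if $d_X(p(a_0),q(a_0))>\sum_{i=1}^n d_X(r_i(a_0),s_i(a_0))$ then $N\cap pHr_1^{ -1}s_1H\cdots Hr_n^{ -1}s_nHq^{ -1}=\emptyset$. -}

module Defs where

open import Level using (0ℓ)
open import Data.Nat using (ℕ)
open import Data.Fin using (Fin; _≟_)
open import Data.Fin.Properties using (any?)
open import Data.Maybe using (Maybe; just; nothing; _>>=_)
import Data.Maybe.Properties as MP
open import Data.Vec using (Vec; lookup; tabulate)
open import Data.List using (List; []; _∷_; _++_; concat; map; foldr)
open import Data.List.NonEmpty using (List⁺; toList)
open import Data.List.Relation.Unary.All using (All)
open import Data.Product using (Σ; ∃; ∃-syntax; _×_; _,_)
open import Data.Sum using (_⊎_)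
open import Data.Unit using (⊤)
open import Relation.Binary.PropositionalEquality using (_≡_; _≢_)
open import Relation.Nullary using (¬_; yes; no)

-- The real numbers, axiomatised as a Dedekind-complete ordered field
-- (agda-stdlib has no real numbers).  Statements quantify over any model.

record RealField : Set₁ where
  infixl 6 _+_
  infixl 7 _*_
  infix  4 _<_ _≤_
  field
    ℝ   : Set
    0r 1r : ℝ
    _+_ _*_ : ℝ → ℝ → ℝ
    -_  : ℝ → ℝ
    _<_ : ℝ → ℝ → Set
    +-assoc   : ∀ x y z → (x + y) + z ≡ x + (y + z)
    +-comm    : ∀ x y → x + y ≡ y + x
    +-identity : ∀ x → 0r + x ≡ x
    +-inverse : ∀ x → (- x) + x ≡ 0r
    *-assoc   : ∀ x y z → (x * y) * z ≡ x * (y * z)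
    *-comm    : ∀ x y → x * y ≡ y * x
    *-identity : ∀ x → 1r * x ≡ x
    *-inverse : ∀ x → x ≢ 0r → ∃[ y ] (y * x ≡ 1r)
    distrib   : ∀ x y z → x * (y + z) ≡ x * y + x * z
    0≢1       : 0r ≢ 1r
    <-irrefl  : ∀ x → ¬ (x < x)
    <-trans   : ∀ {x y z} → x < y → y < z → x < z
    <-trichotomy : ∀ x y → x < y ⊎ x ≡ y ⊎ y < x
    +-mono-<  : ∀ {x y} z → x < y → x + z < y + z
    *-pos     : ∀ {x y} → 0r < x → 0r < y → 0r < x * y

  _≤_ : ℝ → ℝ → Set
  x ≤ y = x < y ⊎ x ≡ y

  field
    complete : (S : ℝ → Set) → ∃[ x ] S x → ∃[ b ] (∀ x → S x → x ≤ b) →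
               ∃[ s ] ((∀ x → S x → x ≤ s) × (∀ b → (∀ x → S x → x ≤ b) → s ≤ b))

module _ (R : RealField) where
  open RealField R

  record IsMetric {A : Set} (d : A → A → ℝ) : Set where
    field
      zero⇔≡  : ∀ x y → (d x y ≡ 0r → x ≡ y) × (x ≡ y → d x y ≡ 0r)
      symm     : ∀ x y → d x y ≡ d y x
      triangle : ∀ x y z → d x z ≤ d x y + d y z

PMap : ℕ → Set
PMap n = Vec (Maybe (Fin n)) n

preimage : ∀ {n} → PMap n → Fin n → Maybe (Fin n)
preimage p y with any? (λ x → MP.≡-dec _≟_ (lookup p x) (just y))
... | yes (x , _) = just x
... | no _ = nothing

invPM : ∀ {n} → PMap n → PMap n
invPM p = tabulate (preimage p)

module _ (R : RealField) {n : ℕ} (dX : Fin n → Fin n → RealField.ℝ R) where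
  open RealField R

  IsPartialIso : PMap n → Set
  IsPartialIso p = ∀ x y x' y' → lookup p x ≡ just x' → lookup p y ≡ just y' →
                   dX x' y' ≡ dX x y

  In𝒫 : PMap n → Set
  In𝒫 p = IsPartialIso p × ∃[ x ] ∃[ y ] (lookup p x ≡ just y × y ≢ x)

-- Words over P (elements of the free group 𝔽(P); the formal inverse of
-- a letter p is the letter invPM p ∈ P).

Word : ℕ → Set
Word n = List (PMap n)

evalX : ∀ {n} → Word n → Fin n → Maybe (Fin n)
evalX [] x = just x
evalX (p ∷ w) x = evalX w x >>= lookup p

InH : ∀ {n} (P : PMap n → Set) (a₀ : Fin n) → Word n → Set
InH P a₀ w = All P w × evalX w a₀ ≡ just a₀

-- elements of P ∪ {1}: nothing stands for 1
InP1 : ∀ {n} (P : PMap n → Set) → Maybe (PMap n) → Set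
InP1 P nothing = ⊤
InP1 P (just p) = P p

app1 : ∀ {n} → Maybe (PMap n) → Fin n → Maybe (Fin n)
app1 nothing x = just x
app1 (just p) x = lookup p x

wd : ∀ {n} → Maybe (PMap n) → Word n
wd nothing = []
wd (just p) = p ∷ []

iwd : ∀ {n} → Maybe (PMap n) → Word n
iwd nothing = []
iwd (just p) = invPM p ∷ []

DefAt : ∀ {n} (P : PMap n → Set) (a₀ : Fin n) → Maybe (PMap n) → Fin n → Set
DefAt P a₀ u x = InP1 P u × app1 u a₀ ≡ just x

module _ (R : RealField) {n : ℕ} (dX : Fin n → Fin n → RealField.ℝ R)
         (P : PMap n → Set) where
  open RealField R

  record SExtension : Set₁ where
    field
      Y   : Set
      dY  : Y → Y → ℝ
      dY-metric : IsMetric R dY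
      ι   : Fin n → Y
      ι-isometric : ∀ a b → dY (ι a) (ι b) ≡ dX a b
      φ   : PMap n → Y → Y                     -- only meaningful on P
      φ-isometry : ∀ p → P p → ∀ y z → dY (φ p y) (φ p z) ≡ dY y z
      φ-extends  : ∀ p → P p → ∀ x x' → lookup p x ≡ just x' → φ p (ι x) ≡ ι x'
      -- φ(p⁻¹) = φ(p)⁻¹ (in particular φ(p) is a bijection, so in Iso(Y))
      φ-inv-left  : ∀ p → P p → ∀ y → φ (invPM p) (φ p y) ≡ y
      φ-inv-right : ∀ p → P p → ∀ y → φ p (φ (invPM p) y) ≡ y

    -- the homomorphism 𝔽(P) → Iso(Y) on words
    evalY : Word n → Y → Y
    evalY [] y = y
    evalY (p ∷ w) y = φ p (evalY w y)

    InKer : Word n → Set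
    InKer w = All P w × (∀ y → evalY w y ≡ y)

module _ (R : RealField) {n : ℕ} (dX : Fin n → Fin n → RealField.ℝ R)
         (P : PMap n → Set) (a₀ : Fin n) (N : Word n → Set) where
  open RealField R

  C1 : Set
  C1 = ∀ p q r s xp xq xr xs →
       DefAt P a₀ p xp → DefAt P a₀ q xq → DefAt P a₀ r xr → DefAt P a₀ s xs →
       dX xp xq ≢ dX xr xs →
       ∀ h₁ h₂ → InH P a₀ h₁ → InH P a₀ h₂ →
       ¬ N (wd p ++ h₁ ++ iwd r ++ wd s ++ h₂ ++ iwd q)

  C2 : Set
  C2 = ∀ p q xp xq → DefAt P a₀ p xp → DefAt P a₀ q xq → xp ≢ xq →
       ∀ h → InH P a₀ h → ¬ N (wd p ++ h ++ iwd q)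

  record Block : Set where
    field
      r s : Maybe (PMap n)
      xr xs : Fin n
      r-def : DefAt P a₀ r xr
      s-def : DefAt P a₀ s xs
      h : Word n
      h-H : InH P a₀ h

  blockWord : Block → Word n
  blockWord b = iwd (Block.r b) ++ wd (Block.s b) ++ Block.h b

  blockDist : Block → ℝ
  blockDist b = dX (Block.xr b) (Block.xs b)

  sumℝ : List ℝ → ℝ
  sumℝ = foldr _+_ 0r

  -- n ≥ 1 blocks: a nonempty list
  C3 : Set
  C3 = ∀ p q xp xq → DefAt P a₀ p xp → DefAt P a₀ q xq →
       ∀ (bs : List⁺ Block) →
       sumℝ (map blockDist (toList bs)) < dX xp xq →
       ∀ h₀ → InH P a₀ h₀ →
       ¬ N (wd p ++ h₀ ++ concat (map blockWord (toList bs)) ++ iwd q)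

-- Every word over P acts on Y as an isometry, and every word of H fixes a₀.
-- Following the points a₀, p(a₀), ... around a word of ker φ therefore gives:
-- (C2) p(a₀) = q(a₀); (C1) the isometry φ(p h₁ r⁻¹) carries r(a₀), s(a₀) to
-- p(a₀), q(a₀); (C3) d(p(a₀), q(a₀)) is the displacement of a₀ under the
-- product of the blocks rᵢ⁻¹ sᵢ hᵢ, which by the triangle inequality is at most
-- the sum of the block displacements d(rᵢ(a₀), sᵢ(a₀)).
module Submission where

open import Defs
open import Data.Nat using (ℕ)
open import Data.Fin using (Fin)
open import Data.Maybe using (just; nothing)
open import Data.Vec using (lookup)
open import Data.Product using (_×_; ∃-syntax; _,_; proj₁; proj₂)
open import Data.Sum using (inj₁; inj₂)
open import Data.List using (List; []; _∷_; _++_; concat; map)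
open import Data.List.NonEmpty using (toList)
open import Data.List.Properties using (++-assoc)
open import Data.List.Relation.Unary.All using (All; []; _∷_)
open import Data.List.Relation.Unary.All.Properties using (++⁺)
open import Relation.Binary.PropositionalEquality
  using (_≡_; _≢_; refl; sym; trans; cong; subst; subst₂; isEquivalence; resp₂)
open import Relation.Binary.PropositionalEquality.Properties using (module ≡-Reasoning)
import Relation.Binary.Construct.StrictToNonStrict as StrictToNonStrict

module RealFieldProperties (R : RealField) where
  open RealField R

  ≤-trans : ∀ {x y z} → x ≤ y → y ≤ z → x ≤ z
  ≤-trans = StrictToNonStrict.trans _≡_ _<_ isEquivalence (resp₂ _<_) <-trans

  ≤-<-trans : ∀ {x y z} → x ≤ y → y < z → x < z
  ≤-<-trans = StrictToNonStrict.≤-<-trans _≡_ _<_ sym <-trans (proj₂ (resp₂ _<_))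

  +-monoˡ-≤ : ∀ {x y} z → x ≤ y → x + z ≤ y + z
  +-monoˡ-≤ z (inj₁ x<y) = inj₁ (+-mono-< z x<y)
  +-monoˡ-≤ z (inj₂ refl) = inj₂ refl

module SExtensionProperties (R : RealField) {n : ℕ}
         (dX : Fin n → Fin n → RealField.ℝ R) (P : PMap n → Set)
         (E : SExtension R dX P) where
  open RealField R
  open SExtension E
  open IsMetric dY-metric using (triangle; zero⇔≡)

  -- A record rather than an equation, so that the word is recoverable by unification.
  record Sends (w : Word n) (y z : Y) : Set where
    constructor sends
    field evalY≡ : evalY w y ≡ z

  evalY-++ : ∀ u v y → evalY (u ++ v) y ≡ evalY u (evalY v y)
  evalY-++ []      v y = refl
  evalY-++ (p ∷ u) v y = cong (φ p) (evalY-++ u v y)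

  sends-++ : ∀ {u v x y z} → Sends u y z → Sends v x y → Sends (u ++ v) x z
  sends-++ {u} {v} {x} (sends u-y) (sends v-x) =
    sends (trans (evalY-++ u v x) (trans (cong (evalY u) v-x) u-y))

  evalY-isometry : ∀ {w} → All P w → ∀ y z → dY (evalY w y) (evalY w z) ≡ dY y z
  evalY-isometry []        y z = refl
  evalY-isometry {p ∷ w} (Pp ∷ Pw) y z =
    trans (φ-isometry p Pp (evalY w y) (evalY w z)) (evalY-isometry Pw y z)

  sends-isometry : ∀ {w y y′ z z′} → All P w → Sends w y y′ → Sends w z z′ →
                   dY y′ z′ ≡ dY y z
  sends-isometry {y = y} {z = z} Pw (sends refl) (sends refl) = evalY-isometry Pw y z

  sends-ι : ∀ {w} → All P w → ∀ {x x′} → evalX w x ≡ just x′ → Sends w (ι x) (ι x′)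
  sends-ι [] refl = sends refl
  sends-ι {p ∷ w} (Pp ∷ Pw) {x} eq with evalX w x in w-x
  ... | just m =
    sends (trans (cong (φ p) (Sends.evalY≡ (sends-ι Pw w-x))) (φ-extends p Pp m _ eq))

  ker-sends : ∀ u v → InKer (u ++ v) → ∀ {y z} → Sends v y z → Sends u z y
  ker-sends u v (_ , fixes) {y} (sends refl) = sends (trans (sym (evalY-++ u v y)) (fixes y))

  ker-fixes : ∀ {w} → InKer w → ∀ {y z} → Sends w y z → z ≡ y
  ker-fixes {w} ker w-y = Sends.evalY≡ (ker-sends [] w ker w-y)

  displacement-++ : ∀ {u} → All P u → ∀ v y →
                    dY (evalY (u ++ v) y) y ≤ dY (evalY v y) y + dY (evalY u y) y
  displacement-++ {u} Pu v y rewrite evalY-++ u v y =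
    subst (λ t → dY (evalY u (evalY v y)) y ≤ t + dY (evalY u y) y)
          (evalY-isometry Pu (evalY v y) y)
          (triangle (evalY u (evalY v y)) (evalY u y) y)

  ι-injective : IsMetric R dX → ∀ {a b} → ι a ≡ ι b → a ≡ b
  ι-injective mX {a} {b} ιa≡ιb = proj₁ (IsMetric.zero⇔≡ mX a b) (begin
    dX a b          ≡⟨ sym (ι-isometric a b) ⟩
    dY (ι a) (ι b)  ≡⟨ cong (dY (ι a)) (sym ιa≡ιb) ⟩
    dY (ι a) (ι a)  ≡⟨ proj₂ (zero⇔≡ (ι a) (ι a)) refl ⟩
    0r              ∎)
    where open ≡-Reasoning

module KernelConditions (R : RealField) {n : ℕ}
         (dX : Fin n → Fin n → RealField.ℝ R) (mX : IsMetric R dX)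
         (a₀ : Fin n) (P : PMap n → Set) (P-inv : ∀ p → P p → P (invPM p))
         (E : SExtension R dX P) where
  open RealField R
  open RealFieldProperties R
  open SExtension E
  open SExtensionProperties R dX P E
  open IsMetric dY-metric using (symm; zero⇔≡)

  wd-all : ∀ u {x} → DefAt P a₀ u x → All P (wd u)
  wd-all nothing _        = []
  wd-all (just p) (Pp , _) = Pp ∷ []

  iwd-all : ∀ u {x} → DefAt P a₀ u x → All P (iwd u)
  iwd-all nothing _        = []
  iwd-all (just p) (Pp , _) = P-inv p Pp ∷ []

  wd-sends : ∀ u {x} → DefAt P a₀ u x → Sends (wd u) (ι a₀) (ι x)
  wd-sends nothing (_ , refl) = sends refl
  wd-sends (just p) (Pp , eq)  = sends (φ-extends p Pp a₀ _ eq)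

  iwd-sends : ∀ u {x} → DefAt P a₀ u x → Sends (iwd u) (ι x) (ι a₀)
  iwd-sends nothing (_ , refl) = sends refl
  iwd-sends (just p) (Pp , eq)  =
    sends (trans (cong (φ (invPM p)) (sym (φ-extends p Pp a₀ _ eq))) (φ-inv-left p Pp (ι a₀)))

  H-sends : ∀ {h} → InH P a₀ h → Sends h (ι a₀) (ι a₀)
  H-sends (Ph , h-a₀) = sends-ι Ph h-a₀

  ker-C2 : C2 R dX P a₀ InKer
  ker-C2 p q xp xq p-def q-def xp≢xq h h-H ker =
    xp≢xq (ι-injective mX (ker-fixes ker
      (sends-++ (wd-sends p p-def) (sends-++ (H-sends h-H) (iwd-sends q q-def)))))

  ker-C1 : C1 R dX P a₀ InKer
  ker-C1 p q r s xp xq xr xs p-def q-def r-def s-def d≢d h₁ h₂ h₁-H h₂-H ker = d≢d (begin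
    dX xp xq         ≡⟨ sym (ι-isometric xp xq) ⟩
    dY (ι xp) (ι xq) ≡⟨ sends-isometry Pu u-xr u-xs ⟩
    dY (ι xr) (ι xs) ≡⟨ ι-isometric xr xs ⟩
    dX xr xs         ∎)
    where
      open ≡-Reasoning
      u t : Word n
      u = wd p ++ h₁ ++ iwd r
      t = wd s ++ h₂ ++ iwd q
      Pu : All P u
      Pu = ++⁺ (wd-all p p-def) (++⁺ (proj₁ h₁-H) (iwd-all r r-def))
      u-xr : Sends u (ι xr) (ι xp)
      u-xr = sends-++ (wd-sends p p-def) (sends-++ (H-sends h₁-H) (iwd-sends r r-def))
      t-xq : Sends t (ι xq) (ι xs)
      t-xq = sends-++ (wd-sends s s-def) (sends-++ (H-sends h₂-H) (iwd-sends q q-def))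
      reassoc : u ++ t ≡ wd p ++ h₁ ++ iwd r ++ t
      reassoc = trans (++-assoc (wd p) (h₁ ++ iwd r) t)
                      (cong (wd p ++_) (++-assoc h₁ (iwd r) t))
      u-xs : Sends u (ι xs) (ι xq)
      u-xs = ker-sends u t (subst InKer (sym reassoc) ker) t-xq

  private
    Block′ : Set
    Block′ = Block R dX P a₀ InKer
    blockWord′ : Block′ → Word n
    blockWord′ = blockWord R dX P a₀ InKer
    blockDist′ : Block′ → ℝ
    blockDist′ = blockDist R dX P a₀ InKer
    sum′ : List ℝ → ℝ
    sum′ = sumℝ R dX P a₀ InKer

  blockWord-all : (b : Block′) → All P (blockWord′ b)
  blockWord-all record { r = r ; s = s ; r-def = r-def ; s-def = s-def ; h-H = h-H } =
    ++⁺ (iwd-all r r-def) (++⁺ (wd-all s s-def) (proj₁ h-H))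

  blockWord-displacement : (b : Block′) →
                           dY (evalY (blockWord′ b) (ι a₀)) (ι a₀) ≡ blockDist′ b
  blockWord-displacement
    record { r = r ; s = s ; xr = xr ; xs = xs ; r-def = r-def ; s-def = s-def ; h-H = h-H } =
    begin
      dY (evalY (iwd r ++ _) (ι a₀)) (ι a₀)
        ≡⟨ cong (λ y → dY y (ι a₀)) (Sends.evalY≡ block-a₀) ⟩
      dY (evalY (iwd r) (ι xs)) (ι a₀)
        ≡⟨ sends-isometry (iwd-all r r-def) (sends refl) (iwd-sends r r-def) ⟩
      dY (ι xs) (ι xr)                     ≡⟨ ι-isometric xs xr ⟩
      dX xs xr                             ≡⟨ IsMetric.symm mX xs xr ⟩
      dX xr xs                             ∎
    where
      open ≡-Reasoning
      block-a₀ : Sends (iwd r ++ wd s ++ _) (ι a₀) (evalY (iwd r) (ι xs))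
      block-a₀ = sends-++ {iwd r} (sends refl) (sends-++ (wd-sends s s-def) (H-sends h-H))

  blockWords-displacement : (bs : List Block′) →
    dY (evalY (concat (map blockWord′ bs)) (ι a₀)) (ι a₀) ≤ sum′ (map blockDist′ bs)
  blockWords-displacement [] = inj₂ (proj₂ (zero⇔≡ (ι a₀) (ι a₀)) refl)
  blockWords-displacement (b ∷ bs) =
    ≤-trans (displacement-++ (blockWord-all b) rest (ι a₀))
            (subst₂ _≤_ (cong (dY (evalY rest (ι a₀)) (ι a₀) +_) (sym (blockWord-displacement b)))
                        (+-comm (sum′ (map blockDist′ bs)) (blockDist′ b))
                        (+-monoˡ-≤ (blockDist′ b) (blockWords-displacement bs)))
    where
      rest : Word n
      rest = concat (map blockWord′ bs)

  ker-C3 : C3 R dX P a₀ InKer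
  ker-C3 p q xp xq p-def q-def bs d< h₀ h₀-H ker =
    <-irrefl (dX xp xq) (≤-<-trans dxp≤sum d<)
    where
      open ≡-Reasoning
      blocks u : Word n
      blocks = concat (map blockWord′ (toList bs))
      u = wd p ++ h₀
      z : Y
      z = evalY blocks (ι a₀)
      u-a₀ : Sends u (ι a₀) (ι xp)
      u-a₀ = sends-++ (wd-sends p p-def) (H-sends h₀-H)
      u-z : Sends u z (ι xq)
      u-z = ker-sends u (blocks ++ iwd q) (subst InKer (sym (++-assoc (wd p) h₀ _)) ker)
                      (sends-++ {blocks} (sends refl) (iwd-sends q q-def))
      dxp≡displacement : dX xp xq ≡ dY z (ι a₀)
      dxp≡displacement = begin
        dX xp xq         ≡⟨ sym (ι-isometric xp xq) ⟩
        dY (ι xp) (ι xq) ≡⟨ sends-isometry (++⁺ (wd-all p p-def) (proj₁ h₀-H)) u-a₀ u-z ⟩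
        dY (ι a₀) z      ≡⟨ symm (ι a₀) z ⟩
        dY z (ι a₀)      ∎
      dxp≤sum : dX xp xq ≤ sum′ (map blockDist′ (toList bs))
      dxp≤sum = subst (_≤ sum′ (map blockDist′ (toList bs))) (sym dxp≡displacement)
                      (blockWords-displacement (toList bs))

lemma4p4 : (R : RealField) {n : ℕ} (dX : Fin n → Fin n → RealField.ℝ R) →
           IsMetric R dX → (a₀ : Fin n) (P : PMap n → Set) →
           (∀ p → P p → In𝒫 R dX p) →
           (∀ p → P p → P (invPM p)) →
           (∀ x → x ≢ a₀ → ∃[ p ] (P p × lookup p a₀ ≡ just x)) →
           (E : SExtension R dX P) →
           C1 R dX P a₀ (SExtension.InKer E) × C2 R dX P a₀ (SExtension.InKer E) ×
           C3 R dX P a₀ (SExtension.InKer E)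
lemma4p4 R dX mX a₀ P _ P-inv _ E = ker-C1 , ker-C2 , ker-C3
  where open KernelConditions R dX mX a₀ P P-inv E
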